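{- Let $q\ge 2$ and $n>1$ be natural numbers, let $\Sigma=\{0,1,\dots,q-1\}$, and let $m=2^n-1$. Then the truth table $T_n(L_q^m)$ is a $Z_{n+1}$-instance over the binary alphabet $\{0,1\}$; that is, there is a non-erasing homomorphism $\phi$ from words over the letters of $Z_{n+1}$ to $\{0,1\}^+$ with $\phi(Z_{n+1})=T_n(L_q^m)$.
   Context: Zimin words are indexed so that $Z_n$ has length $2^n-1$: $Z_1=x_1$ (a single letter), and $Z_{k+1}=Z_k\,x_{k+1}\,Z_k$, where $x_1,x_2,\dots$ are distinct letters. A word $W$ over an alphabet $A$ is an instance of a word $V$ (a $V$-instance) if there is a non-erasing monoid homomorphism $\phi$ from words over the letters of $V$ to $A^+$ (every letter is sent to a nonempty word) with $\phi(V)=W$. $L_q^m$ denotes the sequence of all $q^m$ words of length $m$ over $\Sigma$ listed in lexicographic order with $0<1<\dots<q-1$ (equivalently, ordered by their value as base-$q$ numerals with leading zeros). The truth table $T_n(L_q^m)=t_1t_2\cdots t_{q^m}$ is the binary word of length $q^m$ with $t_i=1$ if and only if the $i$-th word of $L_q^m$ is a $Z_n$-instance, and $t_i=0$ otherwise. (Example: $T_2(L_2^3)=10100101$.) -}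

module Defs where

open import Data.Nat using (ℕ; zero; suc)
open import Data.Fin using (Fin)
open import Data.Bool using (Bool; true; false)
open import Data.List using (List; []; _∷_; _++_; [_]; concatMap; map; allFin)
open import Data.List.Membership.Propositional using (_∈_)
open import Data.List.Relation.Binary.Pointwise using (Pointwise)
open import Data.Product using (Σ; _×_)
open import Relation.Binary.PropositionalEquality using (_≡_; _≢_)
open import Function.Bundles using (_⇔_)

-- Zimin words, letters x_1, x_2, ... encoded as the naturals 0, 1, ...
-- Zimin 0 = empty word (auxiliary), Zimin 1 = x_1, Zimin (k+1) = Zimin k x_{k+1} Zimin k.
Zimin : ℕ → List ℕ
Zimin zero = []
Zimin (suc k) = Zimin k ++ [ k ] ++ Zimin k

IsInstance : {A : Set} → List ℕ → List A → Set
IsInstance {A} V W =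
  Σ (ℕ → List A) λ φ → ((x : ℕ) → x ∈ V → φ x ≢ []) × (concatMap φ V ≡ W)

Lex : (q m : ℕ) → List (List (Fin q))
Lex q zero = [] ∷ []
Lex q (suc m) = concatMap (λ a → map (a ∷_) (Lex q m)) (allFin q)

Encodes : Bool → Set → Set
Encodes b P = (b ≡ true) ⇔ P

IsTruthTable : (n q m : ℕ) → List Bool → Set
IsTruthTable n q m t = Pointwise (λ b w → Encodes b (IsInstance (Zimin n) w)) t (Lex q m)

module Submission where

-- Put m = |Z_n| = 2^n - 1.  A word of length |Z_{n+1}| = 2m + 1 is
-- u c v with |u| = |v| = m, and it is a Z_{n+1}-instance exactly when u = v and
-- u is a Z_n-instance.  Since L_q^(2m+1) lists the words u c v ordered by
-- (u, c, v), the i-th word u_i of L_q^m contributes q copies of the row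
-- 0^i b_i 0^(N-1-i) to T_{n+1}, where b_i is the i-th bit of T_n and N = q^m;
-- this is 'expand q 0 T_n' (the truth-table recursion 'table-step').
--
-- Call Y a ruler word of depth j if Y = 1 for j = 0, and otherwise
-- Y = (Y' g)^(q-1) Y' for a ruler word Y' of depth j-1 and a gap word g.  A ruler
-- word of depth j with non-empty gaps is a Z_{j+1}-instance (send x_{j+1} to
-- g (Y' g)^(q-2)).  The morphism b ↦ (b 0^(N-1))^q 0 maps 'expand q 0 s' followed
-- by 0^N onto the image of s, and it maps ruler words of depth j to ruler words
-- of depth j+1 (followed by 0^N) whose gaps are 0^(N-1) or start with 0.  Hence
-- by induction every T_n is a ruler word of depth n, and for n ≥ 2 (so N ≥ 2)
-- its gaps are non-empty, which makes T_n a Z_{n+1}-instance.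

open import Defs
open import Data.Nat using (ℕ; zero; suc; pred; _+_; _*_; _^_; _∸_; _≤_; _<_; _≥_; _>_; _≟_; z≤n; s≤s)
open import Data.Nat.Properties
  using (+-comm; +-suc; +-identityʳ; *-identityʳ; +-mono-≤; +-monoʳ-≤; +-cancelʳ-≤; +-cancelʳ-≡;
         ≤-antisym; ≤-trans; <⇒≢; m<n⇒m<1+n; n<1+n; m^n>0; ^-monoʳ-≤; m≤n⇒∃[o]m+o≡n)
open import Data.Bool using (Bool; true; false; if_then_else_)
open import Data.Fin using (Fin)
open import Data.List using (List; []; _∷_; _++_; [_]; concatMap; map; allFin; length; replicate; cartesianProductWith)
open import Data.List.Properties
  using (++-assoc; ++-identityʳ; ++-cancelʳ; ++-conicalˡ; ∷-injective; ∷-injectiveˡ; ∷-injectiveʳ;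
         length-++; length-map; length-++-≤ʳ; length-++-sucʳ; length-tabulate;
         map-id; map-++; map-∘; concatMap-++; concatMap-cong; concatMap-map; map-concatMap)
open import Data.List.Effectful using (module MonadProperties)
open import Data.List.Membership.Propositional using (_∈_)
open import Data.List.Membership.Propositional.Properties using (∈-++⁺ˡ; ∈-++⁺ʳ; ∈-++⁻)
open import Data.List.Relation.Unary.Any using (here; there)
open import Data.List.Relation.Unary.All as All using (All; []; _∷_)
import Data.List.Relation.Unary.All.Properties as All
open import Data.List.Relation.Unary.AllPairs using ([]; _∷_)
open import Data.List.Relation.Unary.Unique.Propositional using (Unique)
import Data.List.Relation.Unary.Unique.Propositional.Properties as Unique
open import Data.List.Relation.Binary.Pointwise as Pointwise using (Pointwise; []; _∷_; Pointwise-length)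
open import Data.Product as Product using (Σ; _×_; _,_; proj₁; proj₂)
open import Data.Sum using (inj₁; inj₂)
open import Data.Unit using (⊤; tt)
open import Data.Empty using (⊥-elim)
open import Function using (id; _∘_)
open import Function.Bundles using (_⇔_; mk⇔; Equivalence)
open import Relation.Nullary using (¬_; does; yes; no)
open import Relation.Nullary.Decidable using (dec-true; dec-false)
open import Relation.Binary.PropositionalEquality
  using (_≡_; _≢_; refl; sym; trans; cong; cong₂; subst; module ≡-Reasoning)
open ≡-Reasoning

private
  variable
    A B : Set

-- Words

rep : List A → ℕ → List A
rep w zero = []
rep w (suc k) = w ++ rep w k

zeros : ℕ → List Bool
zeros k = replicate k false

zeros-++ : ∀ a b → zeros a ++ zeros b ≡ zeros (a + b)
zeros-++ zero b = refl
zeros-++ (suc a) b = cong (false ∷_) (zeros-++ a b)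

zeros-snoc : ∀ a → zeros (suc a) ≡ zeros a ++ [ false ]
zeros-snoc a = trans (cong zeros (+-comm 1 a)) (sym (zeros-++ a 1))

rep-snoc : (w : List A) → ∀ k → rep w (suc k) ≡ rep w k ++ w
rep-snoc w zero = ++-identityʳ w
rep-snoc w (suc k) = trans (cong (w ++_) (rep-snoc w k)) (sym (++-assoc w (rep w k) w))

rep-slide : (x y : List A) → ∀ k → rep (x ++ y) k ++ x ≡ x ++ rep (y ++ x) k
rep-slide x y zero = sym (++-identityʳ x)
rep-slide x y (suc k) = begin
  ((x ++ y) ++ rep (x ++ y) k) ++ x  ≡⟨ ++-assoc (x ++ y) _ x ⟩
  (x ++ y) ++ (rep (x ++ y) k ++ x)  ≡⟨ cong ((x ++ y) ++_) (rep-slide x y k) ⟩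
  (x ++ y) ++ (x ++ rep (y ++ x) k)  ≡⟨ ++-assoc x y _ ⟩
  x ++ (y ++ (x ++ rep (y ++ x) k))  ≡⟨ cong (x ++_) (sym (++-assoc y x _)) ⟩
  x ++ ((y ++ x) ++ rep (y ++ x) k)  ∎

concatMap-rep : (f : A → List B) (w : List A) → ∀ k → concatMap f (rep w k) ≡ rep (concatMap f w) k
concatMap-rep f w zero = refl
concatMap-rep f w (suc k) = trans (concatMap-++ f w (rep w k)) (cong (concatMap f w ++_) (concatMap-rep f w k))

concatMap-agree : {f g : A → List B} (xs : List A) → All (λ x → f x ≡ g x) xs → concatMap f xs ≡ concatMap g xs
concatMap-agree [] [] = refl
concatMap-agree (x ∷ xs) (e ∷ es) = cong₂ _++_ e (concatMap-agree xs es)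

++-split : (xs ys xs′ ys′ : List A) → xs ++ ys ≡ xs′ ++ ys′ → length xs ≡ length xs′ → xs ≡ xs′ × ys ≡ ys′
++-split [] ys [] ys′ e _ = refl , e
++-split (x ∷ xs) ys (x′ ∷ xs′) ys′ e l =
  Product.map₁ (cong₂ _∷_ (∷-injectiveˡ e)) (++-split xs ys xs′ ys′ (∷-injectiveʳ e) (cong pred l))

balanced-lengths : ∀ {a f k} → k ≤ a → 1 ≤ f → a + (f + a) ≡ k + suc k → a ≡ k
balanced-lengths {a} {f} {k} k≤a 1≤f total = ≤-antisym a≤k k≤a
  where
  a≤k : a ≤ k
  a≤k = +-cancelʳ-≤ (suc k) a k (subst (a + suc k ≤_) total (+-monoʳ-≤ a (+-mono-≤ 1≤f k≤a)))

sandwich-split : (Φ Y u : List A) (c : A) (v : List A) → 1 ≤ length Y → length u ≤ length Φ →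
  length u ≡ length v → Φ ++ Y ++ Φ ≡ u ++ c ∷ v → Φ ≡ u × Φ ≡ v
sandwich-split Φ Y u c v 1≤|Y| |u|≤|Φ| |u|≡|v| eq = Φ≡u , Φ≡v
  where
  total : length Φ + (length Y + length Φ) ≡ length u + suc (length u)
  total = begin
    length Φ + (length Y + length Φ) ≡⟨ cong (length Φ +_) (sym (length-++ Y)) ⟩
    length Φ + length (Y ++ Φ)       ≡⟨ sym (length-++ Φ) ⟩
    length (Φ ++ Y ++ Φ)             ≡⟨ cong length eq ⟩
    length (u ++ c ∷ v)              ≡⟨ length-++ u ⟩
    length u + suc (length v)        ≡⟨ cong (λ k → length u + suc k) (sym |u|≡|v|) ⟩
    length u + suc (length u)        ∎
  |Φ|≡|u| : length Φ ≡ length u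
  |Φ|≡|u| = balanced-lengths |u|≤|Φ| 1≤|Y| total
  first-split : Φ ≡ u × Y ++ Φ ≡ c ∷ v
  first-split = ++-split Φ (Y ++ Φ) u (c ∷ v) eq |Φ|≡|u|
  Φ≡u : Φ ≡ u
  Φ≡u = proj₁ first-split
  |Y|≡1 : length Y ≡ 1
  |Y|≡1 = +-cancelʳ-≡ (length Φ) (length Y) 1 (begin
    length Y + length Φ  ≡⟨ sym (length-++ Y) ⟩
    length (Y ++ Φ)      ≡⟨ cong length (proj₂ first-split) ⟩
    suc (length v)       ≡⟨ cong suc (trans (sym |u|≡|v|) (sym |Φ|≡|u|)) ⟩
    1 + length Φ         ∎)
  Φ≡v : Φ ≡ v
  Φ≡v = proj₂ (++-split Y Φ [ c ] v (proj₂ first-split) |Y|≡1)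

unique-middle : (pre : List A) {u : A} {post : List A} → Unique (pre ++ u ∷ post) →
  All (u ≢_) pre × All (u ≢_) post
unique-middle [] (u≢post ∷ _) = [] , u≢post
unique-middle (p ∷ pre) {u} (p≢rest ∷ rest) =
  Product.map₁ ((λ u≡p → p≢u (sym u≡p)) ∷_) (unique-middle pre rest)
  where
  p≢u : p ≢ u
  p≢u = All.lookup p≢rest (∈-++⁺ʳ pre (here refl))

length-nonerasing : (φ : ℕ → List A) (V : List ℕ) → (∀ x → x ∈ V → φ x ≢ []) →
  length V ≤ length (concatMap φ V)
length-nonerasing φ [] _ = z≤n
length-nonerasing φ (x ∷ V) ne with φ x | ne x (here refl)
... | [] | φx≢[] = ⊥-elim (φx≢[] refl)
... | y ∷ ys | _ =
  s≤s (≤-trans (length-nonerasing φ V (λ x′ x′∈ → ne x′ (there x′∈))) (length-++-≤ʳ (concatMap φ V) {ys}))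

-- Bits encoding propositions

encodes-true : {P : Set} → P → Encodes true P
encodes-true p = mk⇔ (λ _ → p) (λ _ → refl)

encodes-false : {P : Set} → ¬ P → Encodes false P
encodes-false ¬p = mk⇔ (λ ()) (⊥-elim ∘ ¬p)

encodes-⇔ : {b : Bool} {P Q : Set} → Encodes b P → P ⇔ Q → Encodes b Q
encodes-⇔ e p⇔q = mk⇔ (Equivalence.to p⇔q ∘ Equivalence.to e) (Equivalence.from e ∘ Equivalence.from p⇔q)

encodes-zeros : {Q : B → Set} (f : A → B) (xs : List A) → All (λ x → ¬ Q (f x)) xs →
  Pointwise (λ b w → Encodes b (Q w)) (zeros (length xs)) (map f xs)
encodes-zeros f [] [] = []
encodes-zeros f (x ∷ xs) (¬q ∷ ¬qs) = encodes-false ¬q ∷ encodes-zeros f xs ¬qs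

pointwise-rep : {C : Set} {R : Bool → B → Set} (t : List Bool) (f : C → List B) (cs : List C) →
  (∀ c → Pointwise R t (f c)) → Pointwise R (rep t (length cs)) (concatMap f cs)
pointwise-rep t f [] _ = []
pointwise-rep t f (c ∷ cs) h = Pointwise.++⁺ (h c) (pointwise-rep t f cs h)

-- Zimin words and their instances

Inst : ℕ → List A → Set
Inst n w = IsInstance (Zimin n) w

length-zimin : ∀ n → suc (length (Zimin n)) ≡ 2 ^ n
length-zimin zero = refl
length-zimin (suc n) = begin
  suc (length (Zimin n ++ n ∷ Zimin n))         ≡⟨ cong suc (length-++ (Zimin n)) ⟩
  suc (length (Zimin n)) + suc (length (Zimin n)) ≡⟨ cong₂ _+_ (length-zimin n) (length-zimin n) ⟩
  2 ^ n + 2 ^ n                                   ≡⟨ cong (2 ^ n +_) (sym (+-identityʳ (2 ^ n))) ⟩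
  2 ^ suc n                                       ∎

zimin-letters : ∀ n → All (_< n) (Zimin n)
zimin-letters zero = []
zimin-letters (suc n) = All.++⁺ (All.map m<n⇒m<1+n (zimin-letters n)) (n<1+n n ∷ All.map m<n⇒m<1+n (zimin-letters n))

zimin-nonempty : ∀ n → 1 ≤ length (Zimin (suc n))
zimin-nonempty n = subst (1 ≤_) (sym (length-++-sucʳ (Zimin n) n (Zimin n))) (s≤s z≤n)

concatMap-zimin : (φ : ℕ → List A) → ∀ n →
  concatMap φ (Zimin (suc n)) ≡ concatMap φ (Zimin n) ++ φ n ++ concatMap φ (Zimin n)
concatMap-zimin φ n = concatMap-++ φ (Zimin n) (n ∷ Zimin n)

redefine : (ℕ → List A) → ℕ → List A → ℕ → List A
redefine φ n X x = if does (x ≟ n) then X else φ x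

redefine-same : (φ : ℕ → List A) → ∀ n X → redefine φ n X n ≡ X
redefine-same φ n X rewrite dec-true (n ≟ n) refl = refl

redefine-other : (φ : ℕ → List A) → ∀ {n} X {x} → x ≢ n → redefine φ n X x ≡ φ x
redefine-other φ {n} X {x} x≢n rewrite dec-false (x ≟ n) x≢n = refl

zimin-extend : {A : Set} → ∀ n {W X : List A} → Inst n W → X ≢ [] → Inst (suc n) (W ++ X ++ W)
zimin-extend {A} n {W} {X} (φ , ne , eq) X≢[] = ψ , ne-ψ , image
  where
  ψ : ℕ → List A
  ψ = redefine φ n X
  image : concatMap ψ (Zimin (suc n)) ≡ W ++ X ++ W
  image = begin
    concatMap ψ (Zimin (suc n))                          ≡⟨ concatMap-zimin ψ n ⟩
    concatMap ψ (Zimin n) ++ ψ n ++ concatMap ψ (Zimin n) ≡⟨ cong₂ (λ V Y → V ++ Y ++ V) ψ-on-Zn (redefine-same φ n X) ⟩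
    W ++ X ++ W                                          ∎
    where
    ψ-on-Zn : concatMap ψ (Zimin n) ≡ W
    ψ-on-Zn = trans (concatMap-agree (Zimin n) (All.map (redefine-other φ X ∘ <⇒≢) (zimin-letters n))) eq
  ne-ψ : ∀ x → x ∈ Zimin (suc n) → ψ x ≢ []
  ne-ψ x x∈ with x ≟ n
  ... | yes refl = subst (_≢ []) (sym (redefine-same φ n X)) X≢[]
  ... | no x≢n = subst (_≢ []) (sym (redefine-other φ X x≢n)) (ne x x∈Zn)
    where
    x∈Zn : x ∈ Zimin n
    x∈Zn with ∈-++⁻ (Zimin n) x∈
    ... | inj₁ x∈left = x∈left
    ... | inj₂ (here x≡n) = ⊥-elim (x≢n x≡n)
    ... | inj₂ (there x∈right) = x∈right

middle-instance : {A : Set} → ∀ n u (c : A) v → length u ≡ length (Zimin n) → length v ≡ length (Zimin n) →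
  Inst (suc n) (u ++ c ∷ v) → Inst n u × u ≡ v
middle-instance {A} n u c v |u|≡m |v|≡m (φ , ne , eq) = (φ , ne-Zn , Φ≡u) , trans (sym Φ≡u) Φ≡v
  where
  Φ : List A
  Φ = concatMap φ (Zimin n)
  ne-Zn : ∀ x → x ∈ Zimin n → φ x ≢ []
  ne-Zn x x∈ = ne x (∈-++⁺ˡ x∈)
  |φn|≥1 : 1 ≤ length (φ n)
  |φn|≥1 with φ n | ne n (∈-++⁺ʳ (Zimin n) (here refl))
  ... | [] | φn≢[] = ⊥-elim (φn≢[] refl)
  ... | _ ∷ _ | _ = s≤s z≤n
  |u|≤|Φ| : length u ≤ length Φ
  |u|≤|Φ| = subst (_≤ length Φ) (sym |u|≡m) (length-nonerasing φ (Zimin n) ne-Zn)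
  parts : Φ ≡ u × Φ ≡ v
  parts = sandwich-split Φ (φ n) u c v |φn|≥1 |u|≤|Φ| (trans |u|≡m (sym |v|≡m))
            (trans (sym (concatMap-zimin φ n)) eq)
  Φ≡u : Φ ≡ u
  Φ≡u = proj₁ parts
  Φ≡v : Φ ≡ v
  Φ≡v = proj₂ parts

square-instance : ∀ n u (c : A) → length u ≡ length (Zimin n) → Inst n u ⇔ Inst (suc n) (u ++ c ∷ u)
square-instance n u c |u|≡m =
  mk⇔ (λ inst → zimin-extend n inst (λ ())) (proj₁ ∘ middle-instance n u c u |u|≡m |u|≡m)

-- The lexicographic lists L_q^m

module _ {q : ℕ} where

  Lex-as-product : ∀ m → Lex q (suc m) ≡ cartesianProductWith _∷_ (allFin q) (Lex q m)
  Lex-as-product m = product (allFin q)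
    where
    product : (cs : List (Fin q)) → concatMap (λ c → map (c ∷_) (Lex q m)) cs ≡ cartesianProductWith _∷_ cs (Lex q m)
    product [] = refl
    product (c ∷ cs) = cong (map (c ∷_) (Lex q m) ++_) (product cs)

  Lex-lengths : ∀ m → All (λ w → length w ≡ m) (Lex q m)
  Lex-lengths zero = refl ∷ []
  Lex-lengths (suc m) = All.concat⁺ (All.map⁺ {f = λ c → map (c ∷_) (Lex q m)}
    (All.universal (λ c → All.map⁺ (All.map (cong suc) (Lex-lengths m))) (allFin q)))

  Lex-unique : ∀ m → Unique (Lex q m)
  Lex-unique zero = [] ∷ []
  Lex-unique (suc m) = subst Unique (sym (Lex-as-product m))
    (Unique.cartesianProductWith⁺ _∷_ ∷-injective (Unique.allFin⁺ q) (Lex-unique m))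

  Lex-size : ∀ m → length (Lex q m) ≡ q ^ m
  Lex-size zero = refl
  Lex-size (suc m) = trans (size (allFin q)) (cong₂ _*_ (length-tabulate {n = q} id) (Lex-size m))
    where
    size : (cs : List (Fin q)) → length (concatMap (λ c → map (c ∷_) (Lex q m)) cs) ≡ length cs * length (Lex q m)
    size [] = refl
    size (c ∷ cs) = trans (length-++ (map (c ∷_) (Lex q m)))
      (cong₂ _+_ (length-map (c ∷_) (Lex q m)) (size cs))

  Lex-++ : ∀ a b → Lex q (a + b) ≡ concatMap (λ u → map (u ++_) (Lex q b)) (Lex q a)
  Lex-++ zero b = sym (trans (++-identityʳ _) (map-id (Lex q b)))
  Lex-++ (suc a) b = begin
    concatMap (λ c → map (c ∷_) (Lex q (a + b))) (allFin q)
      ≡⟨ concatMap-cong (λ c → cong (map (c ∷_)) (Lex-++ a b)) (allFin q) ⟩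
    concatMap (λ c → map (c ∷_) (concatMap g (Lex q a))) (allFin q)
      ≡⟨ concatMap-cong (λ c → map-concatMap (c ∷_) g (Lex q a)) (allFin q) ⟩
    concatMap (λ c → concatMap (map (c ∷_) ∘ g) (Lex q a)) (allFin q)
      ≡⟨ concatMap-cong (λ c → concatMap-cong (λ u → sym (map-∘ (Lex q b))) (Lex q a)) (allFin q) ⟩
    concatMap (λ c → concatMap (g ∘ (c ∷_)) (Lex q a)) (allFin q)
      ≡⟨ concatMap-cong (λ c → sym (concatMap-map g (c ∷_) (Lex q a))) (allFin q) ⟩
    concatMap (λ c → concatMap g (map (c ∷_) (Lex q a))) (allFin q)
      ≡⟨ MonadProperties.associative (allFin q) (λ c → map (c ∷_) (Lex q a)) g ⟩
    concatMap g (Lex q (suc a)) ∎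
    where
    g : List (Fin q) → List (List (Fin q))
    g u = map (u ++_) (Lex q b)

-- The truth-table recursion T_n ↦ T_{n+1}

row : Bool → ℕ → ℕ → List Bool
row b i p = zeros i ++ b ∷ zeros p

-- expand q i s: the k-th bit of s contributes q copies of the row of length i + |s|
-- carrying it at position i + k.  Lemma 'table-step' shows expand q 0 T_n = T_{n+1}.
expand : ℕ → ℕ → List Bool → List Bool
expand q i [] = []
expand q i (b ∷ bs) = rep (row b i (length bs)) q ++ expand q (suc i) bs

module TableStep (q n : ℕ) where

  m : ℕ
  m = length (Zimin n)

  L : List (List (Fin q))
  L = Lex q m

  Enc : ℕ → Bool → List (Fin q) → Set
  Enc k b w = Encodes b (Inst k w)

  block : List (Fin q) → List (List (Fin q))
  block u = concatMap (λ c → map (λ v → u ++ c ∷ v) L) (allFin q)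

  Lex-middle : Lex q (length (Zimin (suc n))) ≡ concatMap block L
  Lex-middle = begin
    Lex q (length (Zimin n ++ n ∷ Zimin n))               ≡⟨ cong (Lex q) (length-++ (Zimin n)) ⟩
    Lex q (m + suc m)                                     ≡⟨ Lex-++ m (suc m) ⟩
    concatMap (λ u → map (u ++_) (Lex q (suc m))) L       ≡⟨ concatMap-cong prefix L ⟩
    concatMap block L                                     ∎
    where
    prefix : ∀ u → map (u ++_) (Lex q (suc m)) ≡ block u
    prefix u = trans (map-concatMap (u ++_) (λ c → map (c ∷_) L) (allFin q))
                     (concatMap-cong (λ c → sym (map-∘ L)) (allFin q))

  row-encodes : ∀ pre u post b c → pre ++ u ∷ post ≡ L → Enc n b u →
    Pointwise (Enc (suc n)) (row b (length pre) (length post)) (map (λ v → u ++ c ∷ v) L)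
  row-encodes pre u post b c split enc =
    subst (λ ws → Pointwise (Enc (suc n)) _ (map f ws)) split
      (subst (Pointwise (Enc (suc n)) _) (sym (map-++ f pre (u ∷ post)))
        (Pointwise.++⁺ (encodes-zeros f pre (All.map no-instance (All.zip (lengths-pre , distinct-pre))))
          (encodes-⇔ enc (square-instance n u c |u|≡m)
            ∷ encodes-zeros f post (All.map no-instance (All.zip (lengths-post , distinct-post))))))
    where
    f : List (Fin q) → List (Fin q)
    f v = u ++ c ∷ v
    lengths : All (λ w → length w ≡ m) (pre ++ u ∷ post)
    lengths = subst (All _) (sym split) (Lex-lengths m)
    lengths-pre : All (λ w → length w ≡ m) pre
    lengths-pre = proj₁ (All.++⁻ pre lengths)
    |u|≡m : length u ≡ m
    |u|≡m = All.head (proj₂ (All.++⁻ pre lengths))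
    lengths-post : All (λ w → length w ≡ m) post
    lengths-post = All.tail (proj₂ (All.++⁻ pre lengths))
    distinct : All (u ≢_) pre × All (u ≢_) post
    distinct = unique-middle pre (subst Unique (sym split) (Lex-unique m))
    distinct-pre : All (u ≢_) pre
    distinct-pre = proj₁ distinct
    distinct-post : All (u ≢_) post
    distinct-post = proj₂ distinct
    no-instance : ∀ {v} → length v ≡ m × u ≢ v → ¬ Inst (suc n) (f v)
    no-instance {v} (|v|≡m , u≢v) inst = u≢v (proj₂ (middle-instance n u c v |u|≡m |v|≡m inst))

  -- Invariant of the scan through L = pre ++ rest, with bs the bits of T_n on rest.
  expand-encodes : ∀ pre rest bs → pre ++ rest ≡ L → Pointwise (Enc n) bs rest →
    Pointwise (Enc (suc n)) (expand q (length pre) bs) (concatMap block rest)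
  expand-encodes pre [] [] _ [] = []
  expand-encodes pre (u ∷ post) (b ∷ bs) split (enc ∷ encs) =
    Pointwise.++⁺ this-block (subst (λ i → Pointwise (Enc (suc n)) (expand q i bs) _) |pre∷u| later-blocks)
    where
    |bs|≡|post| : length bs ≡ length post
    |bs|≡|post| = Pointwise-length encs
    this-block : Pointwise (Enc (suc n)) (rep (row b (length pre) (length bs)) q) (block u)
    this-block = subst (λ k → Pointwise (Enc (suc n)) (rep (row b (length pre) (length bs)) k) (block u))
      (length-tabulate {n = q} id)
      (pointwise-rep _ (λ c → map (λ v → u ++ c ∷ v) L) (allFin q)
        (λ c → subst (λ p → Pointwise (Enc (suc n)) (row b (length pre) p) _) (sym |bs|≡|post|)
                 (row-encodes pre u post b c split enc)))
    |pre∷u| : length (pre ++ [ u ]) ≡ suc (length pre)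
    |pre∷u| = trans (length-++ pre) (+-comm (length pre) 1)
    later-blocks : Pointwise (Enc (suc n)) (expand q (length (pre ++ [ u ])) bs) (concatMap block post)
    later-blocks = expand-encodes (pre ++ [ u ]) post bs (trans (++-assoc pre [ u ] post) split) encs

  table-step : ∀ s → IsTruthTable n q m s → IsTruthTable (suc n) q (length (Zimin (suc n))) (expand q 0 s)
  table-step s table = subst (Pointwise (Enc (suc n)) (expand q 0 s)) (sym Lex-middle)
    (expand-encodes [] L s refl table)

-- Ruler words

NonEmpty : List Bool → Set
NonEmpty g = g ≢ []

module Rulers (r : ℕ) where

  q : ℕ
  q = suc (suc r)

  data Ruler (P : List Bool → Set) : ℕ → List Bool → Set where
    base : Ruler P 0 [ true ]
    step : ∀ {j Y} g → Ruler P j Y → P g → Ruler P (suc j) (rep (Y ++ g) (suc r) ++ Y)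

  -- The decomposition Y x_{j+1} Y of a ruler word, with x_{j+1} ↦ g (Y g)^r.
  ruler-shape : (Y g : List Bool) → Y ++ (g ++ rep (Y ++ g) r) ++ Y ≡ rep (Y ++ g) (suc r) ++ Y
  ruler-shape Y g = begin
    Y ++ (g ++ rep (Y ++ g) r) ++ Y  ≡⟨ cong (Y ++_) (++-assoc g (rep (Y ++ g) r) Y) ⟩
    Y ++ g ++ rep (Y ++ g) r ++ Y    ≡⟨ sym (++-assoc Y g _) ⟩
    (Y ++ g) ++ rep (Y ++ g) r ++ Y  ≡⟨ sym (++-assoc (Y ++ g) (rep (Y ++ g) r) Y) ⟩
    rep (Y ++ g) (suc r) ++ Y        ∎

  ruler-instance : ∀ {j Y} → Ruler NonEmpty j Y → Inst (suc j) Y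
  ruler-instance base = (λ _ → [ true ]) , (λ _ _ ()) , refl
  ruler-instance (step {j} {Y} g ruler g≢[]) = subst (Inst (suc (suc j))) (ruler-shape Y g)
    (zimin-extend (suc j) (ruler-instance ruler) (g≢[] ∘ ++-conicalˡ g _))

  blow : ℕ → Bool → List Bool
  blow d b = rep (b ∷ zeros d) q ++ [ false ]

  Blow : ℕ → List Bool → List Bool
  Blow d = concatMap (blow d)

  ruler-blow : ∀ {P j Y} d → P (zeros d) → (∀ g → P (false ∷ g)) → Ruler (λ _ → ⊤) j Y →
    Σ (List Bool) λ Y′ → Ruler P (suc j) Y′ × Blow d Y ≡ Y′ ++ zeros (suc d)
  ruler-blow d P0 P-gap base = rep ([ true ] ++ zeros d) (suc r) ++ [ true ] , step (zeros d) base P0 , image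
    where
    X : List Bool
    X = true ∷ zeros d
    image : blow d true ++ [] ≡ (rep X (suc r) ++ [ true ]) ++ zeros (suc d)
    image = begin
      blow d true ++ []                          ≡⟨ ++-identityʳ _ ⟩
      rep X q ++ [ false ]                        ≡⟨ cong (_++ [ false ]) (rep-snoc X (suc r)) ⟩
      (rep X (suc r) ++ X) ++ [ false ]           ≡⟨ ++-assoc (rep X (suc r)) X _ ⟩
      rep X (suc r) ++ true ∷ zeros d ++ [ false ] ≡⟨ cong (λ z → rep X (suc r) ++ true ∷ z) (sym (zeros-snoc d)) ⟩
      rep X (suc r) ++ [ true ] ++ zeros (suc d)  ≡⟨ sym (++-assoc (rep X (suc r)) [ true ] _) ⟩
      (rep X (suc r) ++ [ true ]) ++ zeros (suc d) ∎
  ruler-blow {P} d P0 P-gap (step {j} {Y} g ruler _) with ruler-blow {P} d P0 P-gap ruler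
  ... | Y′ , ruler′ , blown =
    rep (Y′ ++ g′) (suc r) ++ Y′ , step g′ ruler′ (P-gap (zeros d ++ Blow d g)) , image
    where
    Z : List Bool
    Z = zeros (suc d)
    g′ : List Bool
    g′ = Z ++ Blow d g
    image : Blow d (rep (Y ++ g) (suc r) ++ Y) ≡ (rep (Y′ ++ g′) (suc r) ++ Y′) ++ Z
    image = begin
      Blow d (rep (Y ++ g) (suc r) ++ Y)                ≡⟨ concatMap-++ (blow d) (rep (Y ++ g) (suc r)) Y ⟩
      Blow d (rep (Y ++ g) (suc r)) ++ Blow d Y          ≡⟨ cong (_++ Blow d Y) (concatMap-rep (blow d) (Y ++ g) (suc r)) ⟩
      rep (Blow d (Y ++ g)) (suc r) ++ Blow d Y          ≡⟨ cong (λ z → rep z (suc r) ++ Blow d Y) (concatMap-++ (blow d) Y g) ⟩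
      rep (Blow d Y ++ Blow d g) (suc r) ++ Blow d Y     ≡⟨ cong (λ z → rep (z ++ Blow d g) (suc r) ++ z) blown ⟩
      rep ((Y′ ++ Z) ++ Blow d g) (suc r) ++ (Y′ ++ Z)   ≡⟨ cong (λ z → rep z (suc r) ++ (Y′ ++ Z)) (++-assoc Y′ Z (Blow d g)) ⟩
      rep (Y′ ++ g′) (suc r) ++ (Y′ ++ Z)                ≡⟨ sym (++-assoc (rep (Y′ ++ g′) (suc r)) Y′ Z) ⟩
      (rep (Y′ ++ g′) (suc r) ++ Y′) ++ Z                ∎

  row-blow : ∀ b i p d → i + p ≡ d → rep (row b i p) q ++ zeros (suc i) ≡ zeros i ++ blow d b
  row-blow b i p d i+p≡d = begin
    rep (Zi ++ bZp) q ++ zeros (suc i)      ≡⟨ cong (rep (Zi ++ bZp) q ++_) (zeros-snoc i) ⟩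
    rep (Zi ++ bZp) q ++ Zi ++ [ false ]    ≡⟨ sym (++-assoc (rep (Zi ++ bZp) q) Zi _) ⟩
    (rep (Zi ++ bZp) q ++ Zi) ++ [ false ]  ≡⟨ cong (_++ [ false ]) (rep-slide Zi bZp q) ⟩
    (Zi ++ rep (bZp ++ Zi) q) ++ [ false ]  ≡⟨ ++-assoc Zi (rep (bZp ++ Zi) q) _ ⟩
    Zi ++ rep (bZp ++ Zi) q ++ [ false ]    ≡⟨ cong (λ z → Zi ++ rep (b ∷ z) q ++ [ false ]) zeros-p+i ⟩
    Zi ++ blow d b                          ∎
    where
    Zi : List Bool
    Zi = zeros i
    bZp : List Bool
    bZp = b ∷ zeros p
    zeros-p+i : zeros p ++ zeros i ≡ zeros d
    zeros-p+i = trans (zeros-++ p i) (cong zeros (trans (+-comm p i) i+p≡d))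

  expand-blow : ∀ d i s → i + length s ≡ suc d → expand q i s ++ zeros (suc d) ≡ zeros i ++ Blow d s
  expand-blow d i [] i≡d+1 = trans (cong zeros (trans (sym i≡d+1) (+-identityʳ i))) (sym (++-identityʳ (zeros i)))
  expand-blow d i (b ∷ bs) i+|s|≡d+1 = begin
    (rep Row q ++ expand q (suc i) bs) ++ Z      ≡⟨ ++-assoc (rep Row q) _ Z ⟩
    rep Row q ++ expand q (suc i) bs ++ Z        ≡⟨ cong (rep Row q ++_) (expand-blow d (suc i) bs shifted) ⟩
    rep Row q ++ zeros (suc i) ++ Blow d bs      ≡⟨ sym (++-assoc (rep Row q) _ (Blow d bs)) ⟩
    (rep Row q ++ zeros (suc i)) ++ Blow d bs    ≡⟨ cong (_++ Blow d bs) (row-blow b i (length bs) d (cong pred shifted)) ⟩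
    (zeros i ++ blow d b) ++ Blow d bs           ≡⟨ ++-assoc (zeros i) (blow d b) (Blow d bs) ⟩
    zeros i ++ Blow d (b ∷ bs)                   ∎
    where
    Row : List Bool
    Row = row b i (length bs)
    Z : List Bool
    Z = zeros (suc d)
    shifted : suc i + length bs ≡ suc d
    shifted = trans (sym (+-suc i (length bs))) i+|s|≡d+1

  expand-ruler : ∀ {P j s} d → length s ≡ suc d → P (zeros d) → (∀ g → P (false ∷ g)) →
    Ruler (λ _ → ⊤) j s → Ruler P (suc j) (expand q 0 s)
  expand-ruler {P} {j} {s} d |s|≡d+1 P0 P-gap ruler with ruler-blow d P0 P-gap ruler
  ... | Y′ , ruler′ , blown = subst (Ruler P (suc j)) (sym expand≡Y′) ruler′
    where
    expand≡Y′ : expand q 0 s ≡ Y′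
    expand≡Y′ = ++-cancelʳ (zeros (suc d)) (expand q 0 s) Y′ (trans (expand-blow d 0 s |s|≡d+1) blown)

  Table : ℕ → List Bool → Set
  Table n s = IsTruthTable n q (length (Zimin n)) s

  q^m≥2 : ∀ {m} → 1 ≤ m → 2 ≤ q ^ m
  q^m≥2 1≤m = ≤-trans (subst (2 ≤_) (sym (*-identityʳ q)) (s≤s (s≤s z≤n))) (^-monoʳ-≤ q 1≤m)

  table-size : ∀ n {s} → Table n s → length s ≡ q ^ length (Zimin n)
  table-size n table = trans (Pointwise-length table) (Lex-size (length (Zimin n)))

  table-positive : ∀ n {s} → Table n s → Σ ℕ λ d → length s ≡ suc d
  table-positive n table with m≤n⇒∃[o]m+o≡n (subst (1 ≤_) (sym (table-size n table)) (m^n>0 q (length (Zimin n))))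
  ... | d , 1+d≡|s| = d , sym 1+d≡|s|

  table-at-least-two : ∀ n {s} → Table (suc n) s → Σ ℕ λ d → length s ≡ suc (suc d)
  table-at-least-two n table
    with m≤n⇒∃[o]m+o≡n (subst (2 ≤_) (sym (table-size (suc n) table)) (q^m≥2 (zimin-nonempty n)))
  ... | d , 2+d≡|s| = d , sym 2+d≡|s|

  tables : ∀ n → Σ (List Bool) λ s → Table n s × Ruler (λ _ → ⊤) n s
  tables zero = [ true ] , encodes-true ((λ _ → []) , (λ _ ()) , refl) ∷ [] , base
  tables (suc n) with tables n
  ... | s , table , ruler with table-positive n table
  ...   | d , |s|≡d+1 = expand q 0 s , TableStep.table-step q n s table , expand-ruler d |s|≡d+1 tt (λ _ → tt) ruler

  -- From depth 2 on the gaps 0^(N-1) are non-empty, so T_n is a Z_{n+1}-instance.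
  table-instance : ∀ n → Σ (List Bool) λ t → Table (suc (suc n)) t × Inst (suc (suc (suc n))) t
  table-instance n with tables (suc n)
  ... | s , table , ruler with table-at-least-two n table
  ...   | d , |s|≡d+2 = expand q 0 s , TableStep.table-step q (suc n) s table ,
    ruler-instance (expand-ruler (suc d) |s|≡d+2 (λ ()) (λ _ ()) ruler)

theorem2 : (q n : ℕ) → q ≥ 2 → n > 1 →
    Σ (List Bool) λ t → IsTruthTable n q (2 ^ n ∸ 1) t × IsInstance (Zimin (suc n)) t
theorem2 (suc (suc r)) (suc (suc n)) (s≤s (s≤s z≤n)) (s≤s (s≤s z≤n)) =
  Product.map₂ (Product.map₁ (subst (λ m → IsTruthTable (suc (suc n)) q m _) |Z|≡2^n-1))
    (table-instance n)
  where
  open Rulers r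
  |Z|≡2^n-1 : length (Zimin (suc (suc n))) ≡ 2 ^ suc (suc n) ∸ 1
  |Z|≡2^n-1 = cong (_∸ 1) (length-zimin (suc (suc n)))
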